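{- There is no balancedly splittable Hadamard matrix of order $36$ with any of the parameters $(36,10,4,-2)$, $(36,25,1,-5)$, $(36,14,2,-4)$, or $(36,20,2,-4)$.
   Context: A Hadamard matrix of order $n$ is an $n\times n$ $\{1,-1\}$-matrix $H$ with $HH^\top=nI_n$; $J_n$ is the all-ones matrix. $H$ is balancedly splittable with parameters $(n,\ell,a,b)$ if, after permuting its rows, $H=\begin{pmatrix}H_1\\H_2\end{pmatrix}$ with $H_1$ an $\ell\times n$ matrix such that $H_1^\top H_1=\ell I_n+aA+b(J_n-A-I_n)$ for a symmetric $(0,1)$-matrix $A$ with zero diagonal. -}

module Defs where

open import Data.Nat using (ℕ; zero; suc; _≤_)
open import Data.Fin using (Fin; zero; suc; inject≤)
open import Data.Integer using (ℤ; +_; -_; _+_; _*_; 1ℤ; 0ℤ)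
open import Data.Product using (Σ; _×_; ∃)
open import Data.Sum using (_⊎_)
open import Function.Bundles using (_↔_; Inverse)
open import Relation.Nullary using (yes; no)
open import Data.Fin using (_≟_)
open import Data.Integer using (_-_)
open import Relation.Binary.PropositionalEquality using (_≡_)

∑ : ∀ {n} → (Fin n → ℤ) → ℤ
∑ {zero} f = 0ℤ
∑ {suc n} f = f zero + ∑ (λ i → f (suc i))

Matrix : ℕ → ℕ → Set
Matrix m n = Fin m → Fin n → ℤ

transpose : ∀ {m n} → Matrix m n → Matrix n m
transpose M i j = M j i

_⊗_ : ∀ {m k n} → Matrix m k → Matrix k n → Matrix m n
(M ⊗ N) i j = ∑ (λ t → M i t * N t j)

δ : ∀ {n} → Fin n → Fin n → ℤ
δ i j with i ≟ j
... | yes _ = 1ℤ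
... | no _ = 0ℤ

I : ∀ n → Matrix n n
I n = δ

J : ∀ n → Matrix n n
J n i j = 1ℤ

IsPM1 : ∀ {m n} → Matrix m n → Set
IsPM1 M = ∀ i j → (M i j ≡ 1ℤ) ⊎ (M i j ≡ - 1ℤ)

IsHadamard : ∀ n → Matrix n n → Set
IsHadamard n H = IsPM1 H × (∀ i j → (H ⊗ transpose H) i j ≡ + n * I n i j)

IsAdjacency : ∀ {n} → Matrix n n → Set
IsAdjacency A = (∀ i j → (A i j ≡ 0ℤ) ⊎ (A i j ≡ 1ℤ))
              × (∀ i j → A i j ≡ A j i)
              × (∀ i → A i i ≡ 0ℤ)

-- H is balancedly splittable with parameters (n, ℓ, a, b): after a row
-- permutation σ, the top ℓ rows H₁ satisfy
--   H₁ᵀ H₁ = ℓ I + a A + b (J − A − I)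
-- for some symmetric (0,1)-matrix A with zero diagonal.
BalancedlySplittable : ∀ n → Matrix n n → (ℓ : ℕ) → ℓ ≤ n → ℤ → ℤ → Set
BalancedlySplittable n H ℓ ℓ≤n a b =
  Σ (Fin n ↔ Fin n) λ σ →
  Σ (Matrix n n) λ A →
    IsAdjacency A ×
    (let H₁ : Matrix ℓ n
         H₁ r c = H (Inverse.to σ (inject≤ r ℓ≤n)) c
     in ∀ i j → (transpose H₁ ⊗ H₁) i j
                ≡ + ℓ * I n i j + a * A i j
                  + b * (J n i j - A i j - I n i j))

module Submission where

-- Let H be Hadamard of order n and H₁ its top ℓ rows after the splitting
-- permutation.  The Gram matrix G = H₁ᵀ H₁ then has three properties:
--   * G ² = n G, since H₁ H₁ᵀ = n I (the rows of H₁ are rows of H);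
--   * ℓ + Gᵢⱼ + Gᵢₖ + Gₖⱼ ≡ 0 (mod 4), since 1 + uv + uw + wv ∈ {0, 4}
--     for u, v, w ∈ {±1} (summed over the rows of H₁);
--   * Gᵢᵢ = ℓ and Gᵢⱼ ∈ {a, b} for i ≠ j, by the splitting equation.
-- Put x = G₀₁.  The (0,1) entry of G ² = n G reads
--   ℓ x + x ℓ + Σₖ G₀ₖ Gₖ₁ = n x      (k ranging over the other n - 2 columns),
-- while the mod-4 condition confines every product G₀ₖ Gₖ₁ to an interval
-- [lo, hi] depending on x.  For each of the four parameter sets and both
-- values x ∈ {a, b}, a decidable check shows n x lies outside the resulting
-- window, a contradiction.

open import Defs
open import Data.Nat using (_≤_)
open import Data.Integer using (+_; -_)
open import Data.Product using (_×_)
open import Relation.Nullary using (¬_)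

open import Data.Nat using (ℕ; zero; suc)
open import Data.Integer using (ℤ; 0ℤ; 1ℤ; _+_; _*_; _-_; _≤?_) renaming (_≤_ to _≤ℤ_)
import Data.Integer.Properties as ℤP
open import Data.Integer.Divisibility.Signed using (_∣_; divides; _∣?_; ∣m∣n⇒∣m+n)
open import Data.Integer.Tactic.RingSolver using (solve-∀)
open import Data.Fin using (Fin; zero; suc; inject≤; punchIn; _≟_)
import Data.Fin.Properties as FinP
open import Data.List using (_∷_; [])
open import Data.List.Membership.Propositional using (_∈_)
open import Data.List.Relation.Unary.Any using (here; there)
open import Data.List.Relation.Unary.All as All using (All; all?; _∷_; [])
open import Data.Product using (∃; _,_; proj₁; proj₂)
open import Data.Sum using (_⊎_; inj₁; inj₂)
open import Function using (_∘_; Inverse)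
open import Function.Bundles using (Injection)
open import Function.Properties.Inverse using (↔⇒↣)
open import Relation.Nullary using (Dec; yes; no; contradiction)
open import Relation.Nullary.Decidable using (True; False; toWitness; toWitnessFalse; _×-dec_; _→-dec_)
open import Relation.Binary.PropositionalEquality
  using (_≡_; _≢_; refl; sym; trans; cong; cong₂; subst; module ≡-Reasoning)
open import Algebra.Properties.Semiring.Sum ℤP.+-*-semiring
  using (sum; ∑-distrib-+; ∑-comm; *-distribˡ-sum; *-distribʳ-sum; sum-remove; sum-cong-≗; sum-replicate-zero)

open ≡-Reasoning

-- The recursive ∑ of Defs is the library's semiring sum over ℤ, so the
-- library's summation laws transfer to it.
∑≡sum : ∀ {n} (f : Fin n → ℤ) → ∑ f ≡ sum f
∑≡sum {zero} f = refl
∑≡sum {suc n} f = cong (_+_ (f zero)) (∑≡sum (λ i → f (suc i)))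

∑-cong : ∀ {n} {f g : Fin n → ℤ} → (∀ i → f i ≡ g i) → ∑ f ≡ ∑ g
∑-cong {f = f} {g} f≗g = trans (∑≡sum f) (trans (sum-cong-≗ f≗g) (sym (∑≡sum g)))

∑-+ : ∀ {n} (f g : Fin n → ℤ) → ∑ (λ i → f i + g i) ≡ ∑ f + ∑ g
∑-+ f g = trans (∑≡sum (λ i → f i + g i)) (trans (∑-distrib-+ f g) (sym (cong₂ _+_ (∑≡sum f) (∑≡sum g))))

∑-swap : ∀ {m n} (f : Fin m → Fin n → ℤ) →
         ∑ (λ i → ∑ (λ j → f i j)) ≡ ∑ (λ j → ∑ (λ i → f i j))
∑-swap f = begin
  ∑ (λ i → ∑ (λ j → f i j))       ≡⟨ double f ⟩
  sum (λ i → sum (λ j → f i j))   ≡⟨ ∑-comm f ⟩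
  sum (λ j → sum (λ i → f i j))   ≡⟨ double (λ j i → f i j) ⟨
  ∑ (λ j → ∑ (λ i → f i j))       ∎
  where
  double : ∀ {m n} (g : Fin m → Fin n → ℤ) → ∑ (λ i → ∑ (g i)) ≡ sum (λ i → sum (g i))
  double g = trans (∑-cong (λ i → ∑≡sum (g i))) (∑≡sum (λ i → sum (g i)))

∑-*ˡ : ∀ {n} (c : ℤ) (f : Fin n → ℤ) → c * ∑ f ≡ ∑ (λ i → c * f i)
∑-*ˡ c f = trans (cong (c *_) (∑≡sum f)) (trans (*-distribˡ-sum c f) (sym (∑≡sum (λ i → c * f i))))

∑-*ʳ : ∀ {n} (c : ℤ) (f : Fin n → ℤ) → ∑ f * c ≡ ∑ (λ i → f i * c)
∑-*ʳ c f = trans (cong (_* c) (∑≡sum f)) (trans (*-distribʳ-sum c f) (sym (∑≡sum (λ i → f i * c))))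

∑-single : ∀ {n} (f : Fin n → ℤ) (r : Fin n) → (∀ s → r ≢ s → f s ≡ 0ℤ) → ∑ f ≡ f r
∑-single {suc n} f r vanish = begin
  ∑ f                        ≡⟨ ∑≡sum f ⟩
  sum f                      ≡⟨ sum-remove f ⟩
  f r + sum (f ∘ punchIn r)  ≡⟨ cong (_+_ (f r)) rest-vanishes ⟩
  f r + 0ℤ                   ≡⟨ ℤP.+-identityʳ (f r) ⟩
  f r                        ∎
  where
  rest-vanishes : sum (f ∘ punchIn r) ≡ 0ℤ
  rest-vanishes = trans (sum-cong-≗ (λ k → vanish _ (FinP.punchInᵢ≢i r k ∘ sym)))
                        (sum-replicate-zero n)

∑-const : ∀ {n} (c : ℤ) → ∑ {n} (λ _ → c) ≡ + n * c
∑-const {zero} c = sym (ℤP.*-zeroˡ c)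
∑-const {suc n} c = trans (cong (_+_ c) (∑-const {n} c)) (sym (ℤP.suc-* (+ n) c))

∑-mono-≤ : ∀ {n} {f g : Fin n → ℤ} → (∀ i → f i ≤ℤ g i) → ∑ f ≤ℤ ∑ g
∑-mono-≤ {zero} _ = ℤP.≤-refl
∑-mono-≤ {suc n} f≤g = ℤP.+-mono-≤ (f≤g zero) (∑-mono-≤ (λ i → f≤g (suc i)))

∑-bounds : ∀ {n} (f : Fin n → ℤ) (lo hi : ℤ) → (∀ i → lo ≤ℤ f i × f i ≤ℤ hi) →
           + n * lo ≤ℤ ∑ f × ∑ f ≤ℤ + n * hi
∑-bounds {n} f lo hi bounded =
    subst (_≤ℤ ∑ f) (∑-const {n} lo) (∑-mono-≤ {g = f} (proj₁ ∘ bounded))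
  , subst (∑ f ≤ℤ_) (∑-const {n} hi) (∑-mono-≤ {f = f} (proj₂ ∘ bounded))

∑-∣ : ∀ {n} (d : ℤ) (f : Fin n → ℤ) → (∀ i → d ∣ f i) → d ∣ ∑ f
∑-∣ {zero} d f _ = divides 0ℤ (sym (ℤP.*-zeroˡ d))
∑-∣ {suc n} d f d∣f = ∣m∣n⇒∣m+n (d∣f zero) (∑-∣ d (λ i → f (suc i)) (λ i → d∣f (suc i)))

δ-refl : ∀ {n} (i : Fin n) → δ i i ≡ 1ℤ
δ-refl i with i ≟ i
... | yes _ = refl
... | no i≢i = contradiction refl i≢i

δ-≢ : ∀ {n} (i j : Fin n) → i ≢ j → δ i j ≡ 0ℤ
δ-≢ i j i≢j with i ≟ j
... | yes i≡j = contradiction i≡j i≢j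
... | no _ = refl

δ-injective : ∀ {m n} (ρ : Fin m → Fin n) → (∀ {r s} → ρ r ≡ ρ s → r ≡ s) →
              ∀ r s → δ (ρ r) (ρ s) ≡ δ r s
δ-injective ρ ρ-inj r s with r ≟ s
... | yes refl = δ-refl (ρ r)
... | no r≢s = δ-≢ (ρ r) (ρ s) (r≢s ∘ ρ-inj)

_≋_ : ∀ {m n} → Matrix m n → Matrix m n → Set
M ≋ N = ∀ i j → M i j ≡ N i j

infix 4 _≋_

⊗-assoc : ∀ {m k l n} (M : Matrix m k) (N : Matrix k l) (P : Matrix l n) →
          (M ⊗ N) ⊗ P ≋ M ⊗ (N ⊗ P)
⊗-assoc M N P i j = begin
  ∑ (λ t → ∑ (λ s → M i s * N s t) * P t j)
    ≡⟨ ∑-cong (λ t → ∑-*ʳ (P t j) (λ s → M i s * N s t)) ⟩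
  ∑ (λ t → ∑ (λ s → M i s * N s t * P t j))
    ≡⟨ ∑-swap (λ t s → M i s * N s t * P t j) ⟩
  ∑ (λ s → ∑ (λ t → M i s * N s t * P t j))
    ≡⟨ ∑-cong (λ s → ∑-cong (λ t → ℤP.*-assoc (M i s) (N s t) (P t j))) ⟩
  ∑ (λ s → ∑ (λ t → M i s * (N s t * P t j)))
    ≡⟨ ∑-cong (λ s → ∑-*ˡ (M i s) (λ t → N s t * P t j)) ⟨
  ∑ (λ s → M i s * ∑ (λ t → N s t * P t j))
    ∎

⊗-congʳ : ∀ {m k n} (M : Matrix m k) {N N′ : Matrix k n} → N ≋ N′ → M ⊗ N ≋ M ⊗ N′
⊗-congʳ M N≋N′ i j = ∑-cong (λ t → cong (M i t *_) (N≋N′ t j))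

scalar-⊗ : ∀ {m n} (c : ℤ) {S : Matrix m m} (P : Matrix m n) →
           (∀ i j → S i j ≡ c * δ i j) → S ⊗ P ≋ (λ i j → c * P i j)
scalar-⊗ c {S} P S≡cI i j = begin
  ∑ (λ t → S i t * P t j)  ≡⟨ ∑-single _ i vanish ⟩
  S i i * P i j            ≡⟨ cong (_* P i j) (trans (S≡cI i i) (cong (c *_) (δ-refl i))) ⟩
  c * 1ℤ * P i j           ≡⟨ cong (_* P i j) (ℤP.*-identityʳ c) ⟩
  c * P i j                ∎
  where
  vanish : ∀ t → i ≢ t → S i t * P t j ≡ 0ℤ
  vanish t i≢t = begin
    S i t * P t j         ≡⟨ cong (_* P t j) (trans (S≡cI i t) (cong (c *_) (δ-≢ i t i≢t))) ⟩
    c * 0ℤ * P t j        ≡⟨ cong (_* P t j) (ℤP.*-zeroʳ c) ⟩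
    0ℤ * P t j            ≡⟨ ℤP.*-zeroˡ (P t j) ⟩
    0ℤ                    ∎

⊗-scaleʳ : ∀ {m k n} (M : Matrix m k) (c : ℤ) (P : Matrix k n) →
           M ⊗ (λ i j → c * P i j) ≋ (λ i j → c * (M ⊗ P) i j)
⊗-scaleʳ M c P i j = trans (∑-cong (λ t → swap-scalar (M i t) c (P t j)))
                           (sym (∑-*ˡ c (λ t → M i t * P t j)))
  where
  swap-scalar : ∀ x c y → x * (c * y) ≡ c * (x * y)
  swap-scalar = solve-∀

gram-square : ∀ {ℓ n} (K : Matrix ℓ n) → (∀ r s → (K ⊗ transpose K) r s ≡ + n * δ r s) →
              (transpose K ⊗ K) ⊗ (transpose K ⊗ K) ≋ (λ i j → + n * (transpose K ⊗ K) i j)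
gram-square {ℓ} {n} K rows i j = begin
  ((Kᵀ ⊗ K) ⊗ (Kᵀ ⊗ K)) i j  ≡⟨ ⊗-assoc Kᵀ K (Kᵀ ⊗ K) i j ⟩
  (Kᵀ ⊗ (K ⊗ (Kᵀ ⊗ K))) i j  ≡⟨ ⊗-congʳ Kᵀ (λ r c → sym (⊗-assoc K Kᵀ K r c)) i j ⟩
  (Kᵀ ⊗ ((K ⊗ Kᵀ) ⊗ K)) i j  ≡⟨ ⊗-congʳ Kᵀ (scalar-⊗ (+ n) K rows) i j ⟩
  (Kᵀ ⊗ (λ r c → + n * K r c)) i j  ≡⟨ ⊗-scaleʳ Kᵀ (+ n) K i j ⟩
  + n * (Kᵀ ⊗ K) i j         ∎
  where
  Kᵀ : Matrix n ℓ
  Kᵀ = transpose K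

IsSign : ℤ → Set
IsSign u = u ≡ 1ℤ ⊎ u ≡ - 1ℤ

sign-triple : ∀ {u v w} → IsSign u → IsSign v → IsSign w → + 4 ∣ 1ℤ + u * v + u * w + w * v
sign-triple (inj₁ refl) (inj₁ refl) (inj₁ refl) = divides 1ℤ refl
sign-triple (inj₁ refl) (inj₁ refl) (inj₂ refl) = divides 0ℤ refl
sign-triple (inj₁ refl) (inj₂ refl) (inj₁ refl) = divides 0ℤ refl
sign-triple (inj₁ refl) (inj₂ refl) (inj₂ refl) = divides 0ℤ refl
sign-triple (inj₂ refl) (inj₁ refl) (inj₁ refl) = divides 0ℤ refl
sign-triple (inj₂ refl) (inj₁ refl) (inj₂ refl) = divides 0ℤ refl
sign-triple (inj₂ refl) (inj₂ refl) (inj₁ refl) = divides 0ℤ refl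
sign-triple (inj₂ refl) (inj₂ refl) (inj₂ refl) = divides 1ℤ refl

gram-mod-4 : ∀ {ℓ n} (K : Matrix ℓ n) → IsPM1 K → ∀ i j k →
             + 4 ∣ + ℓ + (transpose K ⊗ K) i j + (transpose K ⊗ K) i k + (transpose K ⊗ K) k j
gram-mod-4 {ℓ} {n} K ±1 i j k =
  subst (+ 4 ∣_) row-sum (∑-∣ (+ 4) _ (λ r → sign-triple (±1 r i) (±1 r j) (±1 r k)))
  where
  G : Matrix n n
  G = transpose K ⊗ K

  ij ik kj : Fin ℓ → ℤ
  ij r = K r i * K r j
  ik r = K r i * K r k
  kj r = K r k * K r j
  row-sum : ∑ (λ r → 1ℤ + ij r + ik r + kj r) ≡ + ℓ + G i j + G i k + G k j
  row-sum = begin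
    ∑ (λ r → 1ℤ + ij r + ik r + kj r)
      ≡⟨ ∑-+ (λ r → 1ℤ + ij r + ik r) kj ⟩
    ∑ (λ r → 1ℤ + ij r + ik r) + ∑ kj
      ≡⟨ cong (_+ ∑ kj) (∑-+ (λ r → 1ℤ + ij r) ik) ⟩
    ∑ (λ r → 1ℤ + ij r) + ∑ ik + ∑ kj
      ≡⟨ cong (λ s → s + ∑ ik + ∑ kj) (∑-+ (λ _ → 1ℤ) ij) ⟩
    ∑ {ℓ} (λ _ → 1ℤ) + ∑ ij + ∑ ik + ∑ kj
      ≡⟨ cong (λ s → s + ∑ ij + ∑ ik + ∑ kj) (trans (∑-const {ℓ} 1ℤ) (ℤP.*-identityʳ (+ ℓ))) ⟩
    + ℓ + G i j + G i k + G k j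
      ∎

record SplitGram (n ℓ : ℕ) (a b : ℤ) (G : Matrix n n) : Set where
  field
    diagonal     : ∀ i → G i i ≡ + ℓ
    off-diagonal : ∀ i j → i ≢ j → G i j ∈ a ∷ b ∷ []
    square       : G ⊗ G ≋ (λ i j → + n * G i j)
    mod-4        : ∀ i j k → + 4 ∣ + ℓ + G i j + G i k + G k j

rhs-diagonal : ∀ ℓ a b → ℓ * 1ℤ + a * 0ℤ + b * (1ℤ - 0ℤ - 1ℤ) ≡ ℓ
rhs-diagonal = solve-∀

rhs-adjacent : ∀ ℓ a b → ℓ * 0ℤ + a * 1ℤ + b * (1ℤ - 1ℤ - 0ℤ) ≡ a
rhs-adjacent = solve-∀

rhs-nonadjacent : ∀ ℓ a b → ℓ * 0ℤ + a * 0ℤ + b * (1ℤ - 0ℤ - 0ℤ) ≡ b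
rhs-nonadjacent = solve-∀

split-gram : ∀ {n ℓ a b} (p : ℓ ≤ n) (H : Matrix n n) → IsHadamard n H →
             BalancedlySplittable n H ℓ p a b → ∃ (SplitGram n ℓ a b)
split-gram {n} {ℓ} {a} {b} p H (±1 , orthogonal) (σ , A , (A01 , _ , A-diagonal) , split) =
  G , record
    { diagonal     = diagonal
    ; off-diagonal = off-diagonal
    ; square       = gram-square K rows
    ; mod-4        = gram-mod-4 K (λ r → ±1 (ρ r))
    }
  where
  ρ : Fin ℓ → Fin n
  ρ r = Inverse.to σ (inject≤ r p)

  ρ-injective : ∀ {r s} → ρ r ≡ ρ s → r ≡ s
  ρ-injective {r} {s} = FinP.inject≤-injective p p r s ∘ Injection.injective (↔⇒↣ σ)

  K : Matrix ℓ n
  K r c = H (ρ r) c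

  G : Matrix n n
  G = transpose K ⊗ K

  rows : ∀ r s → (K ⊗ transpose K) r s ≡ + n * δ r s
  rows r s = trans (orthogonal (ρ r) (ρ s)) (cong (+ n *_) (δ-injective ρ ρ-injective r s))

  rhs : ℤ → ℤ → ℤ
  rhs d x = + ℓ * d + a * x + b * (1ℤ - x - d)

  diagonal : ∀ i → G i i ≡ + ℓ
  diagonal i = trans (split i i) (trans (cong₂ rhs (δ-refl i) (A-diagonal i)) (rhs-diagonal (+ ℓ) a b))

  off-diagonal : ∀ i j → i ≢ j → G i j ∈ a ∷ b ∷ []
  off-diagonal i j i≢j with A01 i j
  ... | inj₁ A≡0 = there (here (trans (split i j)
          (trans (cong₂ rhs (δ-≢ i j i≢j) A≡0) (rhs-nonadjacent (+ ℓ) a b))))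
  ... | inj₂ A≡1 = here (trans (split i j)
          (trans (cong₂ rhs (δ-≢ i j i≢j) A≡1) (rhs-adjacent (+ ℓ) a b)))

-- If the mod-4 condition allows G₀ₖ = y and Gₖ₁ = z next to G₀₁ = x,
-- then the product y z lies in [lo, hi].
Admissible : ℕ → ℤ → ℤ → ℤ → ℤ → ℤ → Set
Admissible ℓ x lo hi y z = + 4 ∣ + ℓ + x + y + z → lo ≤ℤ y * z × y * z ≤ℤ hi

admissible? : ∀ ℓ x lo hi y z → Dec (Admissible ℓ x lo hi y z)
admissible? ℓ x lo hi y z = (+ 4 ∣? _) →-dec ((lo ≤? y * z) ×-dec (y * z ≤? hi))

-- (2 + m) x lies in the window allowed by the (0,1) entry of G ² = (2 + m) G
-- when the m products G₀ₖ Gₖ₁ lie in [lo, hi].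
InWindow : ℕ → ℕ → ℤ → ℤ → ℤ → Set
InWindow m ℓ x lo hi = + ℓ * x + (x * + ℓ + + m * lo) ≤ℤ + suc (suc m) * x
                     × + suc (suc m) * x ≤ℤ + ℓ * x + (x * + ℓ + + m * hi)

inWindow? : ∀ m ℓ x lo hi → Dec (InWindow m ℓ x lo hi)
inWindow? m ℓ x lo hi = (_ ≤? _) ×-dec (_ ≤? _)

-- Evidence that G₀₁ = x is impossible for a split with parameters (2 + m, ℓ, a, b).
record Certificate (m ℓ : ℕ) (a b x : ℤ) : Set where
  field
    lo hi    : ℤ
    products : All (λ y → All (Admissible ℓ x lo hi y) (a ∷ b ∷ [])) (a ∷ b ∷ [])
    gap      : ¬ InWindow m ℓ x lo hi

certify : ∀ {m ℓ a b x} (lo hi : ℤ) →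
          {_ : True (all? (λ y → all? (admissible? ℓ x lo hi y) (a ∷ b ∷ [])) (a ∷ b ∷ []))} →
          {_ : False (inWindow? m ℓ x lo hi)} → Certificate m ℓ a b x
certify lo hi {products} {gap} = record
  { lo = lo ; hi = hi ; products = toWitness products ; gap = toWitnessFalse gap }

refute : ∀ {m ℓ a b} {G : Matrix (suc (suc m)) (suc (suc m))} → SplitGram (suc (suc m)) ℓ a b G →
         ¬ Certificate m ℓ a b (G zero (suc zero))
refute {m} {ℓ} {G = G} S cert = gap (lower-window , upper-window)
  where
  open SplitGram S
  open Certificate cert

  x : ℤ
  x = G zero (suc zero)

  inner : Fin m → ℤ
  inner k = G zero (suc (suc k)) * G (suc (suc k)) (suc zero)

  -- the (0,1) entry of G ² = (2 + m) G, with the diagonal entries split off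
  column : + ℓ * x + (x * + ℓ + ∑ inner) ≡ + suc (suc m) * x
  column = trans (cong₂ (λ g₀₀ g₁₁ → g₀₀ * x + (x * g₁₁ + ∑ inner))
                        (sym (diagonal zero)) (sym (diagonal (suc zero))))
                 (square zero (suc zero))

  bounded : ∀ k → lo ≤ℤ inner k × inner k ≤ℤ hi
  bounded k = All.lookup (All.lookup products (off-diagonal zero (suc (suc k)) λ ()))
                         (off-diagonal (suc (suc k)) (suc zero) λ ())
                         (mod-4 zero (suc zero) (suc (suc k)))

  sum-bounds : + m * lo ≤ℤ ∑ inner × ∑ inner ≤ℤ + m * hi
  sum-bounds = ∑-bounds inner lo hi bounded

  lower-window : + ℓ * x + (x * + ℓ + + m * lo) ≤ℤ + suc (suc m) * x
  lower-window = subst (+ ℓ * x + (x * + ℓ + + m * lo) ≤ℤ_) column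
    (ℤP.+-monoʳ-≤ (+ ℓ * x) (ℤP.+-monoʳ-≤ (x * + ℓ) (proj₁ sum-bounds)))

  upper-window : + suc (suc m) * x ≤ℤ + ℓ * x + (x * + ℓ + + m * hi)
  upper-window = subst (_≤ℤ + ℓ * x + (x * + ℓ + + m * hi)) column
    (ℤP.+-monoʳ-≤ (+ ℓ * x) (ℤP.+-monoʳ-≤ (x * + ℓ) (proj₂ sum-bounds)))

no-splitting : ∀ {m} ℓ a b (H : Matrix (suc (suc m)) (suc (suc m))) → IsHadamard (suc (suc m)) H →
               All (Certificate m ℓ a b) (a ∷ b ∷ []) →
               (p : ℓ ≤ suc (suc m)) → ¬ BalancedlySplittable (suc (suc m)) H ℓ p a b
no-splitting ℓ a b H hadamard certificates p split with split-gram p H hadamard split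
... | G , S = refute S (All.lookup certificates (SplitGram.off-diagonal S zero (suc zero) λ ()))

-- For each (ℓ, a, b) the certificates for G₀₁ = a and G₀₁ = b give the
-- range [lo, hi] of the admissible products G₀ₖ Gₖ₁.
proposition2p21 : (H : Matrix 36 36) → IsHadamard 36 H →
    ((p : 10 ≤ 36) → ¬ BalancedlySplittable 36 H 10 p (+ 4) (- (+ 2)))
    × ((p : 25 ≤ 36) → ¬ BalancedlySplittable 36 H 25 p (+ 1) (- (+ 5)))
    × ((p : 14 ≤ 36) → ¬ BalancedlySplittable 36 H 14 p (+ 2) (- (+ 4)))
    × ((p : 20 ≤ 36) → ¬ BalancedlySplittable 36 H 20 p (+ 2) (- (+ 4)))
proposition2p21 H hadamard =
    no-splitting 10 (+ 4) (- (+ 2)) H hadamard (certify (- (+ 8)) (- (+ 8)) ∷ certify (+ 4) (+ 16) ∷ [])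
  , no-splitting 25 (+ 1) (- (+ 5)) H hadamard (certify (+ 1) (+ 25) ∷ certify (- (+ 5)) (- (+ 5)) ∷ [])
  , no-splitting 14 (+ 2) (- (+ 4)) H hadamard (certify (+ 4) (+ 16) ∷ certify (- (+ 8)) (- (+ 8)) ∷ [])
  , no-splitting 20 (+ 2) (- (+ 4)) H hadamard (certify (- (+ 8)) (- (+ 8)) ∷ certify (+ 4) (+ 16) ∷ [])
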